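{- Let $a,b$ be integers with $3 \mid a$ and $3 \mid b$. Then $4$ cannot be written as the sum of 3 cubes of elements of $LQ_{a,b}$; that is, there are no $x,y,z \in LQ_{a,b}$ with $x^3 + y^3 + z^3 = 4$.
   Context: For integers $a,b$, $LQ_{a,b}$ denotes the quaternion ring $\{\alpha_0 + \alpha_1 \mathbf{i} + \alpha_2 \mathbf{j} + \alpha_3 \mathbf{k} \mid \alpha_n \in \mathbb{Z}\}$ with multiplication determined by $\mathbf{i}^2 = -a$, $\mathbf{j}^2 = -b$, $\mathbf{i}\mathbf{j} = -\mathbf{j}\mathbf{i} = \mathbf{k}$. -}

module Defs where

open import Data.Integer using (ℤ; _+_; _*_; _-_; +_)

-- Elements α₀ + α₁ i + α₂ j + α₃ k of LQ_{a,b} with integer coefficients.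
record LQ (a b : ℤ) : Set where
  constructor quat
  field
    c₀ c₁ c₂ c₃ : ℤ

open LQ public

-- Multiplication determined by i² = -a, j² = -b, ij = -ji = k
-- (hence k² = -ab, ik = -a j, ki = a j, jk = b i, kj = -b i).
_·_ : ∀ {a b} → LQ a b → LQ a b → LQ a b
_·_ {a} {b} (quat x₀ x₁ x₂ x₃) (quat y₀ y₁ y₂ y₃) = quat
  (x₀ * y₀ - a * (x₁ * y₁) - b * (x₂ * y₂) - (a * b) * (x₃ * y₃))
  (x₀ * y₁ + x₁ * y₀ + b * (x₂ * y₃) - b * (x₃ * y₂))
  (x₀ * y₂ + x₂ * y₀ - a * (x₁ * y₃) + a * (x₃ * y₁))
  (x₀ * y₃ + x₃ * y₀ + x₁ * y₂ - x₂ * y₁)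

_⊕_ : ∀ {a b} → LQ a b → LQ a b → LQ a b
quat x₀ x₁ x₂ x₃ ⊕ quat y₀ y₁ y₂ y₃ = quat (x₀ + y₀) (x₁ + y₁) (x₂ + y₂) (x₃ + y₃)

cube : ∀ {a b} → LQ a b → LQ a b
cube x = x · (x · x)

fromℤ : ∀ {a b} → ℤ → LQ a b
fromℤ n = quat n (+ 0) (+ 0) (+ 0)

-- The argument only looks at real parts modulo 9.
--   * For any a, b the real part of x³, for x = p + q i + r j + s k, is
--     p³ − 3·p·N(x) with N(x) = a q² + b r² + ab s² (the norm of the pure
--     part).  When 3 divides a and b, 3 divides N(x), so the real part of
--     x³ is congruent to p³ modulo 9.
--   * Every integer cube is congruent to 0, 1 or −1 modulo 9: reduce the
--     base modulo 9 (cubing respects congruences) and check the nine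
--     residues.
--   * A sum of three elements of {0, 1, −1} lies in [−3, 3], so it is never
--     congruent to 4 modulo 9 (a finite check).
-- Taking real parts of x³ + y³ + z³ = 4 gives p₁³ + p₂³ + p₃³ ≡ 4 (mod 9),
-- which the last two facts exclude.
module Submission where

open import Defs
import Data.Nat as ℕ
open import Data.Integer using (ℤ; +_; -_; _+_; _*_; _-_)
open import Data.Integer.Divisibility using (_∣_)
open import Data.Integer.Divisibility.Signed as Signed
  using (divides; ∣ᵤ⇒∣; _∣?_; ∣m⇒∣m*n; ∣m∣n⇒∣m+n)
open import Data.Integer.DivMod using (_%ℕ_; _/ℕ_; n%ℕd<d; a≡a%ℕn+[a/ℕn]*n)
open import Data.Integer.Tactic.RingSolver using (solve-∀)
open import Data.Fin using (Fin; toℕ; fromℕ<)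
open import Data.Fin.Properties using (toℕ-fromℕ<)
import Data.Fin.Properties as Fin
open import Data.List using (List; []; _∷_)
open import Data.List.Relation.Unary.All as All using (All)
open import Data.List.Relation.Unary.Any as Any using (Any)
open import Data.Product using (∃-syntax; _,_)
open import Relation.Nullary using (¬_; ¬?; Dec)
import Relation.Nullary.Decidable as Dec
open import Relation.Nullary.Decidable using (toWitness)
open import Relation.Binary.PropositionalEquality using (_≡_; refl; sym; subst; cong; module ≡-Reasoning)

-- Integer cubes.  (The ring solver does not unfold definitions, so lemmas
-- proved by it spell out x * x * x.)
infix 8 _³

_³ : ℤ → ℤ
x ³ = x * x * x

-- It is a record
-- rather than a synonym so that x, y and n can be inferred from it.
infix 4 _≡_mod_ _≡?_mod_

record _≡_mod_ (x y n : ℤ) : Set where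
  constructor congruent
  field divides-difference : n Signed.∣ x - y

open _≡_mod_

_≡?_mod_ : ∀ x y n → Dec (x ≡ y mod n)
x ≡? y mod n = Dec.map′ congruent divides-difference (n ∣? x - y)

≡mod-reflexive : ∀ {n x y} → x ≡ y → x ≡ y mod n
≡mod-reflexive {n} {x} refl = congruent (divides (+ 0) (difference-zero x))
  where
  difference-zero : ∀ x → x - x ≡ + 0 * n
  difference-zero = solve-∀

≡mod-trans : ∀ {n x y z} → x ≡ y mod n → y ≡ z mod n → x ≡ z mod n
≡mod-trans {n} {x} {y} {z} (congruent n∣x-y) (congruent n∣y-z) =
  congruent (subst (n Signed.∣_) (telescope x y z) (∣m∣n⇒∣m+n n∣x-y n∣y-z))
  where
  telescope : ∀ x y z → (x - y) + (y - z) ≡ x - z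
  telescope = solve-∀

≡mod-+ : ∀ {n x x′ y y′} → x ≡ x′ mod n → y ≡ y′ mod n → x + y ≡ x′ + y′ mod n
≡mod-+ {n} {x} {x′} {y} {y′} (congruent n∣x-x′) (congruent n∣y-y′) =
  congruent (subst (n Signed.∣_) (regroup x x′ y y′) (∣m∣n⇒∣m+n n∣x-x′ n∣y-y′))
  where
  regroup : ∀ x x′ y y′ → (x - x′) + (y - y′) ≡ (x + y) - (x′ + y′)
  regroup = solve-∀

≡mod-cube : ∀ {n x y} → x ≡ y mod n → x ³ ≡ y ³ mod n
≡mod-cube {n} {x} {y} (congruent n∣x-y) =
  congruent (subst (n Signed.∣_) (sym (difference-of-cubes x y)) (∣m⇒∣m*n (x * x + x * y + y * y) n∣x-y))
  where
  difference-of-cubes : ∀ x y → x * x * x - y * y * y ≡ (x - y) * (x * x + x * y + y * y)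
  difference-of-cubes = solve-∀

≡mod-remainder : ∀ x d .{{_ : ℕ.NonZero d}} → x ≡ + (x %ℕ d) mod + d
≡mod-remainder x d =
  congruent (divides (x /ℕ d) (cancel-remainder x (+ (x %ℕ d)) (x /ℕ d) (a≡a%ℕn+[a/ℕn]*n x d)))
  where
  cancel-remainder : ∀ x r q → x ≡ r + q * + d → x - r ≡ q * + d
  cancel-remainder x r q refl = lemma r q (+ d)
    where
    lemma : ∀ r q m → r + q * m - r ≡ q * m
    lemma = solve-∀

cubeResidues : List ℤ
cubeResidues = + 0 ∷ + 1 ∷ - + 1 ∷ []

small-cube-residue : ∀ (r : Fin 9) → Any (λ c → (+ toℕ r) ³ ≡ c mod + 9) cubeResidues
small-cube-residue = toWitness {a? = Fin.all? (λ r → Any.any? (λ c → (+ toℕ r) ³ ≡? c mod + 9) cubeResidues)} _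

cube-residue : ∀ x → Any (λ c → x ³ ≡ c mod + 9) cubeResidues
cube-residue x =
  Any.map (≡mod-trans (≡mod-cube (≡mod-remainder x 9)))
    (subst (λ r → Any (λ c → (+ r) ³ ≡ c mod + 9) cubeResidues)
      (toℕ-fromℕ< remainder<9) (small-cube-residue (fromℕ< remainder<9)))
  where
  remainder<9 = n%ℕd<d x 9

residue-sums-avoid-4 :
  All (λ u → All (λ v → All (λ w → ¬ (+ 4 ≡ u + v + w mod + 9)) cubeResidues) cubeResidues) cubeResidues
residue-sums-avoid-4 = toWitness {a? = all-sums} _
  where
  all-sums = All.all? (λ u → All.all? (λ v → All.all? (λ w →
               ¬? (+ 4 ≡? u + v + w mod + 9)) cubeResidues) cubeResidues) cubeResidues

sum-of-three-cubes-≢-4 : ∀ p₁ p₂ p₃ → ¬ (+ 4 ≡ p₁ ³ + p₂ ³ + p₃ ³ mod + 9)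
sum-of-three-cubes-≢-4 p₁ p₂ p₃ 4≡sum =
  let avoid₁ , p₁≡c₁ = All.lookupAny residue-sums-avoid-4 (cube-residue p₁)
      avoid₂ , p₂≡c₂ = All.lookupAny avoid₁ (cube-residue p₂)
      avoid₃ , p₃≡c₃ = All.lookupAny avoid₂ (cube-residue p₃)
  in avoid₃ (≡mod-trans 4≡sum (≡mod-+ (≡mod-+ p₁≡c₁ p₂≡c₂) p₃≡c₃))

pureNorm : ∀ {a b} → LQ a b → ℤ
pureNorm {a} {b} x = a * (c₁ x * c₁ x) + b * (c₂ x * c₂ x) + (a * b) * (c₃ x * c₃ x)

real-part-cube : ∀ {a b} (x : LQ a b) → c₀ (cube x) ≡ c₀ x ³ - + 3 * (c₀ x * pureNorm x)
real-part-cube {a} {b} x = expand a b (c₀ x) (c₁ x) (c₂ x) (c₃ x)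
  where
  expand : ∀ a b p q r s →
    p * (p * p - a * (q * q) - b * (r * r) - (a * b) * (s * s))
    - a * (q * (p * q + q * p + b * (r * s) - b * (s * r)))
    - b * (r * (p * r + r * p - a * (q * s) + a * (s * q)))
    - (a * b) * (s * (p * s + s * p + q * r - r * q))
    ≡ p * p * p - + 3 * (p * (a * (q * q) + b * (r * r) + (a * b) * (s * s)))
  expand = solve-∀

three∣pureNorm : ∀ {a b} → + 3 Signed.∣ a → + 3 Signed.∣ b → (x : LQ a b) → + 3 Signed.∣ pureNorm x
three∣pureNorm {a} {b} 3∣a 3∣b x =
  ∣m∣n⇒∣m+n (∣m∣n⇒∣m+n (∣m⇒∣m*n (c₁ x * c₁ x) 3∣a) (∣m⇒∣m*n (c₂ x * c₂ x) 3∣b))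
    (∣m⇒∣m*n (c₃ x * c₃ x) (∣m⇒∣m*n b 3∣a))

real-part-cube-mod-9 : ∀ {a b} → + 3 Signed.∣ a → + 3 Signed.∣ b →
  (x : LQ a b) → c₀ (cube x) ≡ c₀ x ³ mod + 9
real-part-cube-mod-9 3∣a 3∣b x with three∣pureNorm 3∣a 3∣b x
... | divides k N≡3k = congruent (divides (- (c₀ x * k)) (begin
  c₀ (cube x) - c₀ x ³                         ≡⟨ cong (_- c₀ x ³) (real-part-cube x) ⟩
  c₀ x ³ - + 3 * (c₀ x * pureNorm x) - c₀ x ³  ≡⟨ cong (λ N → c₀ x ³ - + 3 * (c₀ x * N) - c₀ x ³) N≡3k ⟩
  c₀ x ³ - + 3 * (c₀ x * (k * + 3)) - c₀ x ³   ≡⟨ cancel (c₀ x) k ⟩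
  - (c₀ x * k) * + 9                           ∎))
  where
  open ≡-Reasoning
  cancel : ∀ p k → p * p * p - + 3 * (p * (k * + 3)) - p * p * p ≡ - (p * k) * + 9
  cancel = solve-∀

mainTheorem11 : (a b : ℤ) → + 3 ∣ a → + 3 ∣ b →
    ¬ (∃[ x ] ∃[ y ] ∃[ z ] (cube {a} {b} x ⊕ cube y) ⊕ cube z ≡ fromℤ (+ 4))
mainTheorem11 a b 3∣a 3∣b (x , y , z , sum≡4) =
  sum-of-three-cubes-≢-4 (c₀ x) (c₀ y) (c₀ z)
    (≡mod-trans (≡mod-reflexive (cong c₀ (sym sum≡4)))
      (≡mod-+ (≡mod-+ (re-cube x) (re-cube y)) (re-cube z)))
  where
  re-cube : (w : LQ a b) → c₀ (cube w) ≡ c₀ w ³ mod + 9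
  re-cube = real-part-cube-mod-9 (∣ᵤ⇒∣ 3∣a) (∣ᵤ⇒∣ 3∣b)
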